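{- Let $p$ be a prime, $q$ a power of $p$, $m \in \mathbb{F}_q$, and let $F = F(p,m)$ be the $p \times p$ fundamental block. Let $\alpha, \beta, \gamma \in \mathbb{F}_q$ and let $B = (b_{i,j})_{0 \le i,j \le 2p-1}$ be a $2p \times 2p$ matrix over $\mathbb{F}_q$ whose upper-left, upper-right and lower-left $p \times p$ blocks are $\alpha F$, $\beta F$ and $\gamma F$ respectively, and whose lower-right block is obtained by the recurrence $b_{i,j} = b_{i-1,j} + m\, b_{i-1,j-1} + b_{i,j-1}$ for all $p \le i, j \le 2p-1$. Then the lower-right $p\times p$ block of $B$ equals $\delta F$, where $\delta = \varphi(m)\alpha + \beta + \gamma = m^p \alpha + \beta + \gamma$.
   Context: For $m \in \mathbb{F}_q$, the fundamental block $F(p,m) = (a_{i,j})_{0 \le i,j \le p-1}$ is the $p\times p$ matrix over $\mathbb{F}_q$ with $a_{i,0} = a_{0,j} = 1$ and $a_{i,j} = a_{i-1,j} + m\, a_{i-1,j-1} + a_{i,j-1}$ for $i,j \ge 1$. $\varphi : \mathbb{F}_q \to \mathbb{F}_q$, $\varphi(x) = x^p$, is the Frobenius automorphism. -}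

module Defs where

open import Level using (Level; _⊔_)
open import Data.Nat using (ℕ; zero; suc)
open import Data.Fin using (Fin)
open import Data.Product using (∃)
open import Relation.Binary.PropositionalEquality using (_≡_)
open import Relation.Nullary using (¬_)
open import Algebra.Bundles using (CommutativeRing)

record FiniteField (q : ℕ) (c ℓ : Level) : Set (Level.suc (c ⊔ ℓ)) where
  field
    commRing : CommutativeRing c ℓ
  open CommutativeRing commRing public
  field
    0≉1       : ¬ (0# ≈ 1#)
    inverse   : ∀ x → ¬ (x ≈ 0#) → ∃ λ y → x * y ≈ 1#
    enum      : Fin q → Carrier
    enum-inj  : ∀ a b → enum a ≈ enum b → a ≡ b
    enum-surj : ∀ x → ∃ λ a → enum a ≈ x

module _ {c ℓ : Level} (R : CommutativeRing c ℓ) where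
  open CommutativeRing R

  pow : Carrier → ℕ → Carrier
  pow x zero    = 1#
  pow x (suc n) = x * pow x n

  -- Entries a_{i,j} of the fundamental block F(p,m), for all i, j ∈ ℕ
  -- (the p×p block F(p,m) consists of the entries with 0 ≤ i,j ≤ p-1):
  -- a_{i,0} = a_{0,j} = 1, a_{i,j} = a_{i-1,j} + m a_{i-1,j-1} + a_{i,j-1}.
  fund : Carrier → ℕ → ℕ → Carrier
  fund m zero    j       = 1#
  fund m (suc i) zero    = 1#
  fund m (suc i) (suc j) = fund m i (suc j) + m * fund m i j + fund m (suc i) j

module Submission where

-- The fundamental block has the Delannoy-type closed form F(i,j) = Σₖ C(i,k) C(j,k) (1 + m)ᵏ.
-- In characteristic p the coefficients C(p,k), 0 < k < p, vanish, so row p of F is 1 on [0,p).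
-- The recurrence then gives F(p-1,j+1) = -m F(p-1,j), hence F(p-1,j) = (-m)ʲ and
-- m F(p-1,p-1) = mᵖ. So the lower-right block of B has constant first row and first column
-- δ = mᵖα + β + γ, and since the recurrence is linear that block is δF. Finally, a field
-- with pᵏ elements has characteristic p.

open import Defs
open import Level using (Level)
open import Data.Nat as N using (ℕ; zero; suc; _<_; _≤_; _!; z≤n; s≤s)
open import Data.Nat.Primality using (Prime; euclidsLemma; prime⇒nonTrivial; prime⇒nonZero; prime⇒irreducible)
open import Data.Nat.Divisibility using (_∣_; divides; ∣⇒≤; ∣1⇒≡1; m∣m*n; ∣-refl)
open import Data.Nat.Combinatorics using (_C_; nCn≡1; nCk+nC[k+1]≡[n+1]C[k+1]; nCk≡n!/k![n-k]!; k>n⇒nCk≡0; k![n∸k]!∣n!)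
open import Data.Nat.DivMod using (m/n*n≡m)
import Data.Nat.Properties as NP
open import Data.Fin as Fin using (Fin; toℕ; inject₁; fromℕ)
open import Data.Fin.Properties using (toℕ<n; toℕ-inject₁; toℕ-fromℕ)
open import Data.Fin.Permutation using (Permutation; permutation)
open import Data.Vec.Functional using (Vector)
open import Data.Product using (∃-syntax; _,_; proj₁; proj₂)
open import Data.Sum using (_⊎_; inj₁; inj₂)
open import Data.Empty using (⊥-elim)
open import Function using (_∘_)
open import Relation.Nullary using (¬_; yes; no)
open import Relation.Nullary.Decidable using (map′)
open import Relation.Binary.Definitions using (Decidable)
open import Relation.Binary.PropositionalEquality as ≡ using (_≡_)
open import Algebra.Bundles using (CommutativeRing)

n∣n! : ∀ n → .{{N.NonZero n}} → n ∣ n !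
n∣n! (suc n) = m∣m*n (n !)

nCk*k![n-k]!≡n! : ∀ {n k} → k ≤ n → (n C k) N.* (k ! N.* (n N.∸ k) !) ≡ n !
nCk*k![n-k]!≡n! {n} {k} k≤n =
  ≡.trans (≡.cong (λ c → c N.* (k ! N.* (n N.∸ k) !)) (nCk≡n!/k![n-k]! k≤n))
          (m/n*n≡m {{NP._!*_!≢0 k (n N.∸ k)}} (k![n∸k]!∣n! k≤n))

module _ {p : ℕ} (pp : Prime p) where

  prime∣n!⇒p≤n : ∀ n → p ∣ n ! → p ≤ n
  prime∣n!⇒p≤n zero p∣1 =
    ⊥-elim (NP.<⇒≢ (N.nonTrivial⇒n>1 p {{prime⇒nonTrivial pp}}) (≡.sym (∣1⇒≡1 p∣1)))
  prime∣n!⇒p≤n (suc n) p∣n! with euclidsLemma (suc n) (n !) pp p∣n!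
  ... | inj₁ p∣1+n = ∣⇒≤ p∣1+n
  ... | inj₂ p∣n!  = NP.m≤n⇒m≤1+n (prime∣n!⇒p≤n n p∣n!)

  prime∣pCk : ∀ {k} → 0 < k → k < p → p ∣ p C k
  prime∣pCk {k} 0<k k<p with euclidsLemma (p C k) (k ! N.* (p N.∸ k) !) pp p∣pCk*d
    where
    p∣pCk*d : p ∣ (p C k) N.* (k ! N.* (p N.∸ k) !)
    p∣pCk*d = ≡.subst (p ∣_) (≡.sym (nCk*k![n-k]!≡n! (NP.<⇒≤ k<p))) (n∣n! p {{prime⇒nonZero pp}})
  ... | inj₁ p∣pCk = p∣pCk
  ... | inj₂ p∣d with euclidsLemma (k !) ((p N.∸ k) !) pp p∣d
  ...   | inj₁ p∣k!     = ⊥-elim (NP.<⇒≱ k<p (prime∣n!⇒p≤n k p∣k!))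
  ...   | inj₂ p∣[p-k]! = ⊥-elim (NP.<⇒≱ (NP.∸-monoʳ-< 0<k (NP.<⇒≤ k<p)) (prime∣n!⇒p≤n (p N.∸ k) p∣[p-k]!))

even⊎odd : ∀ n → ∃[ h ] (n ≡ h N.+ h ⊎ n ≡ suc (h N.+ h))
even⊎odd zero = 0 , inj₁ ≡.refl
even⊎odd (suc n) with even⊎odd n
... | h , inj₁ ≡.refl = h , inj₂ ≡.refl
... | h , inj₂ ≡.refl = suc h , inj₁ (≡.cong suc (≡.sym (NP.+-suc h h)))

even-prime≡2 : ∀ h → Prime (h N.+ h) → h N.+ h ≡ 2
even-prime≡2 h pp with prime⇒irreducible pp (divides h h+h≡h*2)
  where
  h+h≡h*2 : h N.+ h ≡ h N.* 2
  h+h≡h*2 = ≡.trans (≡.cong (h N.+_) (≡.sym (NP.+-identityʳ h))) (NP.*-comm 2 h)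
... | inj₁ ()
... | inj₂ 2≡h+h = ≡.sym 2≡h+h

module _ {q : ℕ} {c ℓ : Level} (K : FiniteField q c ℓ) where
  open FiniteField K
  open import Algebra.Properties.Semiring.Mult semiring using (_×_; ×1-homo-*)
  open import Algebra.Properties.Semiring.Sum semiring using (sum; sum-permute; sum-cong-≋; ∑-distrib-+; sum-replicate)
  open import Algebra.Properties.Ring ring using (+-identityʳ-unique)
  open import Relation.Binary.Reasoning.Setoid setoid

  ≈-dec : Decidable _≈_
  ≈-dec x y with enum-surj x | enum-surj y
  ... | a , ea | b , eb =
    map′ (λ a≡b → trans (sym ea) (trans (reflexive (≡.cong enum a≡b)) eb))
         (λ x≈y → enum-inj a b (trans ea (trans x≈y (sym eb))))
         (a Fin.≟ b)

  translate : Carrier → Fin q → Fin q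
  translate t a = proj₁ (enum-surj (enum a + t))

  enum-translate : ∀ t a → enum (translate t a) ≈ enum a + t
  enum-translate t a = proj₂ (enum-surj (enum a + t))

  translate-cancel : ∀ {s t} → s + t ≈ 0# → ∀ a → translate t (translate s a) ≡ a
  translate-cancel {s} {t} s+t≈0 a = enum-inj _ _ (begin
    enum (translate t (translate s a)) ≈⟨ enum-translate t _ ⟩
    enum (translate s a) + t           ≈⟨ +-congʳ (enum-translate s a) ⟩
    enum a + s + t                     ≈⟨ +-assoc _ s t ⟩
    enum a + (s + t)                   ≈⟨ +-congˡ s+t≈0 ⟩
    enum a + 0#                        ≈⟨ +-identityʳ _ ⟩
    enum a                             ∎)

  translation : Carrier → Permutation q q
  translation t = permutation (translate t) (translate (- t))
    (translate-cancel (-‿inverseˡ t)) (translate-cancel (-‿inverseʳ t))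

  -- Translating every element by 1 permutes K, so it does not change the sum of all elements.
  card×1≈0 : q × 1# ≈ 0#
  card×1≈0 = +-identityʳ-unique (sum enum) (q × 1#) (sym (begin
    sum enum                            ≈⟨ sum-permute enum (translation 1#) ⟩
    sum (enum ∘ translate 1#)           ≈⟨ sum-cong-≋ (enum-translate 1#) ⟩
    sum (λ a → enum a + 1#)             ≈⟨ ∑-distrib-+ enum (λ _ → 1#) ⟩
    sum enum + sum {q} (λ _ → 1#)       ≈⟨ +-congˡ (sum-replicate q) ⟩
    sum enum + q × 1#                   ∎))

  x*y≈0⇒y≈0 : ∀ {x y} → ¬ x ≈ 0# → x * y ≈ 0# → y ≈ 0#
  x*y≈0⇒y≈0 {x} {y} x≉0 xy≈0 with inverse x x≉0
  ... | x⁻¹ , xx⁻¹≈1 = begin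
    y               ≈⟨ sym (*-identityˡ y) ⟩
    1# * y          ≈⟨ *-congʳ (sym (trans (*-comm x⁻¹ x) xx⁻¹≈1)) ⟩
    x⁻¹ * x * y     ≈⟨ *-assoc x⁻¹ x y ⟩
    x⁻¹ * (x * y)   ≈⟨ *-congˡ xy≈0 ⟩
    x⁻¹ * 0#        ≈⟨ zeroʳ x⁻¹ ⟩
    0#              ∎

  pow≉0 : ∀ {x} k → ¬ x ≈ 0# → ¬ pow commRing x k ≈ 0#
  pow≉0 zero    x≉0 1≈0 = 0≉1 (sym 1≈0)
  pow≉0 (suc k) x≉0 xᵏ⁺¹≈0 = pow≉0 k x≉0 (x*y≈0⇒y≈0 x≉0 xᵏ⁺¹≈0)

  ^×1≈pow : ∀ n k → (n N.^ k) × 1# ≈ pow commRing (n × 1#) k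
  ^×1≈pow n zero    = +-identityʳ 1#
  ^×1≈pow n (suc k) = trans (×1-homo-* n (n N.^ k)) (*-congˡ (^×1≈pow n k))

  characteristic : ∀ p k → q ≡ p N.^ k → p × 1# ≈ 0#
  characteristic p k q≡pᵏ with ≈-dec (p × 1#) 0#
  ... | yes p≈0 = p≈0
  ... | no  p≉0 = ⊥-elim (pow≉0 k p≉0 (begin
    pow commRing (p × 1#) k  ≈⟨ sym (^×1≈pow p k) ⟩
    (p N.^ k) × 1#           ≡⟨ ≡.cong (_× 1#) q≡pᵏ ⟨
    q × 1#                   ≈⟨ card×1≈0 ⟩
    0#                       ∎))

module _ {a ℓ : Level} (R : CommutativeRing a ℓ) where
  open CommutativeRing R
  open import Algebra.Properties.Semiring.Mult semiring using (_×_; ×-congˡ; ×-congʳ; ×-homo-1; ×-homo-+; ×-comm-*; ×-assoc-*; ×1-homo-*)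
  open import Algebra.Properties.CommutativeMonoid.Mult +-commutativeMonoid using (×-distrib-+)
  open import Algebra.Properties.Semiring.Sum semiring
    using (sum; sum-syntax; sum⁺-syntax; sum-cong-≋; ∑-distrib-+; *-distribˡ-sum; sum-init-last; sum-replicate; sum-replicate-zero)
  open import Algebra.Properties.Ring ring using (+-identityˡ-unique; +-inverseˡ-unique; -‿distribˡ-*; -‿distribʳ-*; -‿involutive)
  open import Algebra.Properties.CommutativeSemigroup *-commutativeSemigroup using (x∙yz≈y∙xz)
  open import Algebra.Properties.CommutativeSemigroup +-commutativeSemigroup
    using () renaming (x∙yz≈xz∙y to x+[y+z]≈[x+z]+y; xy∙z≈zy∙x to [x+y]+z≈[z+y]+x)
  open import Relation.Binary.Reasoning.Setoid setoid

  sum-vanish : ∀ {n} (f : Vector Carrier n) → (∀ k → f k ≈ 0#) → sum f ≈ 0#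
  sum-vanish {n} f f≈0 = trans (sum-cong-≋ f≈0) (sum-replicate-zero n)

  ×-zeroʳ : ∀ n → n × 0# ≈ 0#
  ×-zeroʳ n = trans (sym (sum-replicate n)) (sum-replicate-zero n)

  binomialTransform : (ℕ → Carrier) → ℕ → Carrier
  binomialTransform x n = ∑[ k ≤ n ] ((n C toℕ k) × x (toℕ k))

  binomialTransform-cong : ∀ {x y} → (∀ k → x k ≈ y k) → ∀ n → binomialTransform x n ≈ binomialTransform y n
  binomialTransform-cong x≈y n = sum-cong-≋ {suc n} (λ k → ×-congʳ (n C toℕ k) (x≈y (toℕ k)))

  binomialTransform-+ : ∀ x y n →
    binomialTransform (λ k → x k + y k) n ≈ binomialTransform x n + binomialTransform y n
  binomialTransform-+ x y n = begin
    ∑[ k ≤ n ] ((n C toℕ k) × (x (toℕ k) + y (toℕ k)))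
      ≈⟨ sum-cong-≋ {suc n} (λ k → ×-distrib-+ (x (toℕ k)) (y (toℕ k)) (n C toℕ k)) ⟩
    ∑[ k ≤ n ] ((n C toℕ k) × x (toℕ k) + (n C toℕ k) × y (toℕ k))
      ≈⟨ ∑-distrib-+ {suc n} (λ k → (n C toℕ k) × x (toℕ k)) (λ k → (n C toℕ k) × y (toℕ k)) ⟩
    binomialTransform x n + binomialTransform y n ∎

  *-binomialTransform : ∀ a x n → a * binomialTransform x n ≈ binomialTransform (λ k → a * x k) n
  *-binomialTransform a x n =
    trans (*-distribˡ-sum {suc n} a (λ k → (n C toℕ k) × x (toℕ k))) (sum-cong-≋ {suc n} (λ k → ×-comm-* (n C toℕ k) a (x (toℕ k))))

  binomialTransform-vanish : ∀ x → (∀ k → x k ≈ 0#) → ∀ n → binomialTransform x n ≈ 0#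
  binomialTransform-vanish x x≈0 n =
    sum-vanish {suc n} (λ k → (n C toℕ k) × x (toℕ k)) (λ k → trans (×-congʳ (n C toℕ k) (x≈0 (toℕ k))) (×-zeroʳ (n C toℕ k)))

  binomialTransform-suc : ∀ x n →
    binomialTransform x (suc n) ≈ binomialTransform x n + binomialTransform (x ∘ suc) n
  binomialTransform-suc x n = begin
    1 × x 0 + ∑[ k < suc n ] ((suc n C suc (toℕ k)) × y (toℕ k))
      ≈⟨ +-congˡ (sum-cong-≋ {suc n} (λ k → pascal (toℕ k))) ⟩
    1 × x 0 + ∑[ k < suc n ] ((n C toℕ k) × y (toℕ k) + (n C suc (toℕ k)) × y (toℕ k))
      ≈⟨ +-congˡ (∑-distrib-+ {suc n} (λ k → (n C toℕ k) × y (toℕ k)) (λ k → (n C suc (toℕ k)) × y (toℕ k))) ⟩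
    1 × x 0 + (binomialTransform y n + ∑[ k < suc n ] ((n C suc (toℕ k)) × y (toℕ k)))
      ≈⟨ +-congˡ (+-congˡ (sum-init-last {n} (λ k → (n C suc (toℕ k)) × y (toℕ k)))) ⟩
    1 × x 0 + (binomialTransform y n + (∑[ k < n ] ((n C suc (toℕ (inject₁ k))) × y (toℕ (inject₁ k)))
                                        + (n C suc (toℕ (fromℕ n))) × y (toℕ (fromℕ n))))
      ≈⟨ +-congˡ (+-congˡ (+-cong (sum-cong-≋ {n} (λ k → reflexive (≡.cong (λ t → (n C suc t) × y t) (toℕ-inject₁ k))))
                                  lastTerm≈0)) ⟩
    1 × x 0 + (binomialTransform y n + (∑[ k < n ] ((n C suc (toℕ k)) × y (toℕ k)) + 0#))
      ≈⟨ +-congˡ (+-congˡ (+-identityʳ _)) ⟩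
    1 × x 0 + (binomialTransform y n + ∑[ k < n ] ((n C suc (toℕ k)) × y (toℕ k)))
      ≈⟨ x+[y+z]≈[x+z]+y _ _ _ ⟩
    binomialTransform x n + binomialTransform y n ∎
    where
    y = x ∘ suc
    pascal : ∀ k → (suc n C suc k) × y k ≈ (n C k) × y k + (n C suc k) × y k
    pascal k = trans (×-congˡ (≡.sym (nCk+nC[k+1]≡[n+1]C[k+1] n k))) (×-homo-+ (y k) (n C k) (n C suc k))
    lastTerm≈0 : (n C suc (toℕ (fromℕ n))) × y (toℕ (fromℕ n)) ≈ 0#
    lastTerm≈0 rewrite toℕ-fromℕ n | k>n⇒nCk≡0 (NP.n<1+n n) = refl

  module _ (m : Carrier) where

    fund-zeroʳ : ∀ i → fund R m i 0 ≈ 1#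
    fund-zeroʳ zero    = refl
    fund-zeroʳ (suc i) = refl

    fund-sym : ∀ i j → fund R m i j ≈ fund R m j i
    fund-sym zero    zero    = refl
    fund-sym zero    (suc j) = refl
    fund-sym (suc i) zero    = refl
    fund-sym (suc i) (suc j) = begin
      fund R m i (suc j) + m * fund R m i j + fund R m (suc i) j
        ≈⟨ +-cong (+-cong (fund-sym i (suc j)) (*-congˡ (fund-sym i j))) (fund-sym (suc i) j) ⟩
      fund R m (suc j) i + m * fund R m j i + fund R m j (suc i)
        ≈⟨ [x+y]+z≈[z+y]+x _ _ _ ⟩
      fund R m j (suc i) + m * fund R m j i + fund R m (suc j) i ∎

    delannoyCoefficient : ℕ → ℕ → Carrier
    delannoyCoefficient j k = (j C k) × pow R (1# + m) k

    delannoyCoefficient-vanish : ∀ {j k} → j < k → delannoyCoefficient j k ≈ 0#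
    delannoyCoefficient-vanish j<k rewrite k>n⇒nCk≡0 j<k = refl

    delannoyCoefficient-suc : ∀ j k → delannoyCoefficient (suc j) (suc k) ≈
      (1# + m) * delannoyCoefficient j k + delannoyCoefficient j (suc k)
    delannoyCoefficient-suc j k = begin
      (suc j C suc k) × ((1# + m) * P)                       ≡⟨ ≡.cong (_× ((1# + m) * P)) (nCk+nC[k+1]≡[n+1]C[k+1] j k) ⟨
      (j C k N.+ j C suc k) × ((1# + m) * P)                 ≈⟨ ×-homo-+ _ (j C k) (j C suc k) ⟩
      (j C k) × ((1# + m) * P) + (j C suc k) × ((1# + m) * P) ≈⟨ +-congʳ (×-comm-* (j C k) (1# + m) P) ⟨
      (1# + m) * ((j C k) × P) + (j C suc k) × ((1# + m) * P) ∎
      where P = pow R (1# + m) k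

    fund≈binomialTransform : ∀ i j → fund R m i j ≈ binomialTransform (delannoyCoefficient j) i
    fund≈binomialTransform zero j =
      sym (trans (+-identityʳ _) (trans (×-homo-1 _) (×-homo-1 1#)))
    fund≈binomialTransform (suc i) zero = sym (begin
      binomialTransform c₀ (suc i)                          ≈⟨ binomialTransform-suc c₀ i ⟩
      binomialTransform c₀ i + binomialTransform (c₀ ∘ suc) i ≈⟨ +-cong (sym (fund≈binomialTransform i 0))
                                                                       (binomialTransform-vanish (c₀ ∘ suc) (λ _ → refl) i) ⟩
      fund R m i 0 + 0#                                     ≈⟨ +-identityʳ _ ⟩
      fund R m i 0                                          ≈⟨ fund-zeroʳ i ⟩
      1#                                                    ∎)
      where c₀ = delannoyCoefficient 0
    fund≈binomialTransform (suc i) (suc j) = begin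
      fund R m i (suc j) + m * fund R m i j + fund R m (suc i) j
        ≈⟨ +-cong (+-cong (fund≈binomialTransform i (suc j)) (*-congˡ (fund≈binomialTransform i j)))
                  (fund≈binomialTransform (suc i) j) ⟩
      T c′ i + m * T c i + T c (suc i)
        ≈⟨ +-congˡ (binomialTransform-suc c i) ⟩
      T c′ i + m * T c i + (T c i + T (c ∘ suc) i)
        ≈⟨ +-assoc _ _ _ ⟩
      T c′ i + (m * T c i + (T c i + T (c ∘ suc) i))
        ≈⟨ +-congˡ (sym (+-assoc _ _ _)) ⟩
      T c′ i + (m * T c i + T c i + T (c ∘ suc) i)
        ≈⟨ +-congˡ (+-congʳ (trans (+-comm _ _) (trans (+-congʳ (sym (*-identityˡ _))) (sym (distribʳ (T c i) 1# m))))) ⟩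
      T c′ i + ((1# + m) * T c i + T (c ∘ suc) i)
        ≈⟨ +-congˡ (+-congʳ (*-binomialTransform (1# + m) c i)) ⟩
      T c′ i + (T (λ k → (1# + m) * c k) i + T (c ∘ suc) i)
        ≈⟨ +-congˡ (sym (binomialTransform-+ (λ k → (1# + m) * c k) (c ∘ suc) i)) ⟩
      T c′ i + T (λ k → (1# + m) * c k + c (suc k)) i
        ≈⟨ +-congˡ (binomialTransform-cong (λ k → sym (delannoyCoefficient-suc j k)) i) ⟩
      T c′ i + T (c′ ∘ suc) i
        ≈⟨ binomialTransform-suc c′ i ⟨
      T c′ (suc i) ∎
      where
      T = binomialTransform
      c = delannoyCoefficient j
      c′ = delannoyCoefficient (suc j)

    *-distrib-+m* : ∀ x u v → x * u + m * (x * v) ≈ x * (u + m * v)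
    *-distrib-+m* x u v = trans (+-congˡ (x∙yz≈y∙xz m x v)) (sym (distribˡ x u (m * v)))

    fund-unique : ∀ n δ (h : ℕ → ℕ → Carrier) →
      (∀ j → j < n → h 0 j ≈ δ) → (∀ i → i < n → h i 0 ≈ δ) →
      (∀ i j → suc i < n → suc j < n → h (suc i) (suc j) ≈ h i (suc j) + m * h i j + h (suc i) j) →
      ∀ i j → i < n → j < n → h i j ≈ δ * fund R m i j
    fund-unique n δ h top left step = go
      where
      go : ∀ i j → i < n → j < n → h i j ≈ δ * fund R m i j
      go zero    j       _ j<n = trans (top j j<n) (sym (*-identityʳ δ))
      go (suc i) zero    i<n _ = trans (left (suc i) i<n) (sym (*-identityʳ δ))
      go (suc i) (suc j) i<n j<n = begin
        h (suc i) (suc j)                                               ≈⟨ step i j i<n j<n ⟩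
        h i (suc j) + m * h i j + h (suc i) j                           ≈⟨ +-cong (+-cong (go i (suc j) i<n′ j<n)
                                                                             (*-congˡ (go i j i<n′ j<n′))) (go (suc i) j i<n j<n′) ⟩
        δ * fund R m i (suc j) + m * (δ * fund R m i j) + δ * fund R m (suc i) j
                                                                        ≈⟨ +-congʳ (*-distrib-+m* δ _ _) ⟩
        δ * (fund R m i (suc j) + m * fund R m i j) + δ * fund R m (suc i) j
                                                                        ≈⟨ distribˡ δ _ _ ⟨
        δ * fund R m (suc i) (suc j)                                    ∎
        where
        i<n′ = NP.<⇒≤ i<n
        j<n′ = NP.<⇒≤ j<n

  -x*-x≈x*x : ∀ x → - x * - x ≈ x * x
  -x*-x≈x*x x = trans (sym (-‿distribˡ-* x (- x))) (trans (-‿cong (sym (-‿distribʳ-* x x))) (-‿involutive (x * x)))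

  pow-neg-even : ∀ x h → pow R (- x) (h N.+ h) ≈ pow R x (h N.+ h)
  pow-neg-even x zero    = refl
  pow-neg-even x (suc h) = begin
    pow R (- x) (suc h N.+ suc h)       ≡⟨ ≡.cong (pow R (- x) ∘ suc) (NP.+-suc h h) ⟩
    - x * (- x * pow R (- x) (h N.+ h)) ≈⟨ *-assoc (- x) (- x) _ ⟨
    - x * - x * pow R (- x) (h N.+ h)   ≈⟨ *-cong (-x*-x≈x*x x) (pow-neg-even x h) ⟩
    x * x * pow R x (h N.+ h)           ≈⟨ *-assoc x x _ ⟩
    x * (x * pow R x (h N.+ h))         ≡⟨ ≡.cong (pow R x ∘ suc) (NP.+-suc h h) ⟨
    pow R x (suc h N.+ suc h)           ∎

  module _ (p-1 : ℕ) (pp : Prime (suc p-1)) (p×1≈0 : suc p-1 × 1# ≈ 0#) where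

    private
      p : ℕ
      p = suc p-1

    ∣⇒×≈0 : ∀ {n} → p ∣ n → ∀ x → n × x ≈ 0#
    ∣⇒×≈0 (divides d ≡.refl) x = begin
      (d N.* p) × x                ≈⟨ ×-congʳ (d N.* p) (*-identityˡ x) ⟨
      (d N.* p) × (1# * x)         ≈⟨ ×-assoc-* (d N.* p) 1# x ⟨
      (d N.* p) × 1# * x           ≈⟨ *-congʳ (×1-homo-* d p) ⟩
      (d × 1#) * (p × 1#) * x      ≈⟨ *-congʳ (*-congˡ p×1≈0) ⟩
      (d × 1#) * 0# * x            ≈⟨ *-congʳ (zeroʳ _) ⟩
      0# * x                       ≈⟨ zeroˡ x ⟩
      0#                           ∎

    -- (1 + Δ)ᵖ = 1 + Δᵖ: the middle binomial coefficients vanish in characteristic p.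
    binomialTransform-char : ∀ x → binomialTransform x p ≈ x 0 + x p
    binomialTransform-char x = begin
      1 × x 0 + ∑[ k < p ] f k                             ≈⟨ +-cong (×-homo-1 (x 0)) (sum-init-last {p-1} f) ⟩
      x 0 + (∑[ k < p-1 ] f (inject₁ k) + f (fromℕ p-1))  ≈⟨ +-congˡ (+-cong (sum-vanish {p-1} (f ∘ inject₁) middle≈0) last≈xp) ⟩
      x 0 + (0# + x p)                                     ≈⟨ +-congˡ (+-identityˡ (x p)) ⟩
      x 0 + x p                                            ∎
      where
      f : Vector Carrier p
      f k = (p C suc (toℕ k)) × x (suc (toℕ k))
      middle≈0 : ∀ k → f (inject₁ k) ≈ 0#
      middle≈0 k rewrite toℕ-inject₁ k = ∣⇒×≈0 (prime∣pCk pp (s≤s z≤n) (s≤s (toℕ<n k))) _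
      last≈xp : f (fromℕ p-1) ≈ x p
      last≈xp rewrite toℕ-fromℕ p-1 | nCn≡1 p = ×-homo-1 (x p)

    pow-neg-[p-1] : ∀ x → pow R (- x) p-1 ≈ pow R x p-1
    pow-neg-[p-1] x with even⊎odd p-1
    ... | h , inj₁ p-1≡h+h = ≡.subst (λ n → pow R (- x) n ≈ pow R x n) (≡.sym p-1≡h+h) (pow-neg-even x h)
    ... | h , inj₂ p-1≡1+h+h = ≡.subst (λ n → pow R (- x) n ≈ pow R x n) (≡.sym p-1≡1) (*-congʳ -x≈x)
      where
      p≡2 : p ≡ 2
      p≡2 = ≡.trans p≡[1+h]+[1+h] (even-prime≡2 (suc h) (≡.subst Prime p≡[1+h]+[1+h] pp))
        where
        p≡[1+h]+[1+h] : p ≡ suc h N.+ suc h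
        p≡[1+h]+[1+h] = ≡.cong suc (≡.trans p-1≡1+h+h (≡.sym (NP.+-suc h h)))
      p-1≡1 : p-1 ≡ 1
      p-1≡1 = ≡.cong N.pred p≡2
      -x≈x : - x ≈ x
      -x≈x = sym (+-inverseˡ-unique x x (begin
        x + x          ≈⟨ +-congˡ (+-identityʳ x) ⟨
        2 × x          ≈⟨ ∣⇒×≈0 (≡.subst (_∣ 2) (≡.sym p≡2) ∣-refl) x ⟩
        0#             ∎))

    module _ (m : Carrier) where

      fund-row-p : ∀ j → j < p → fund R m p j ≈ 1#
      fund-row-p j j<p = begin
        fund R m p j                                          ≈⟨ fund≈binomialTransform m p j ⟩
        binomialTransform (delannoyCoefficient m j) p         ≈⟨ binomialTransform-char (delannoyCoefficient m j) ⟩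
        delannoyCoefficient m j 0 + delannoyCoefficient m j p ≈⟨ +-cong (×-homo-1 1#) (delannoyCoefficient-vanish m j<p) ⟩
        1# + 0#                                               ≈⟨ +-identityʳ 1# ⟩
        1#                                                    ∎

      fund-row-[p-1]-step : ∀ j → suc j < p → fund R m p-1 (suc j) + m * fund R m p-1 j ≈ 0#
      fund-row-[p-1]-step j 1+j<p =
        +-identityˡ-unique _ (fund R m p j) (trans (fund-row-p (suc j) 1+j<p) (sym (fund-row-p j (NP.<⇒≤ 1+j<p))))

      fund-column-[p-1]-step : ∀ i → suc i < p → fund R m (suc i) p-1 + m * fund R m i p-1 ≈ 0#
      fund-column-[p-1]-step i 1+i<p =
        trans (+-cong (fund-sym m (suc i) p-1) (*-congˡ (fund-sym m i p-1))) (fund-row-[p-1]-step i 1+i<p)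

      fund-row-[p-1] : ∀ j → j < p → fund R m p-1 j ≈ pow R (- m) j
      fund-row-[p-1] zero    _     = fund-zeroʳ m p-1
      fund-row-[p-1] (suc j) 1+j<p = begin
        fund R m p-1 (suc j)     ≈⟨ +-inverseˡ-unique _ _ (fund-row-[p-1]-step j 1+j<p) ⟩
        - (m * fund R m p-1 j)   ≈⟨ -‿cong (*-congˡ (fund-row-[p-1] j (NP.<⇒≤ 1+j<p))) ⟩
        - (m * pow R (- m) j)    ≈⟨ -‿distribˡ-* m _ ⟩
        - m * pow R (- m) j      ∎

      m*fund[p-1,p-1]≈mᵖ : m * fund R m p-1 p-1 ≈ pow R m p
      m*fund[p-1,p-1]≈mᵖ = *-congˡ (trans (fund-row-[p-1] p-1 (NP.n<1+n p-1)) (pow-neg-[p-1] m))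

      module _ (α β γ : Carrier) (b : ℕ → ℕ → Carrier)
        (hA : ∀ i j → i < p → j < p → b i j ≈ α * fund R m i j)
        (hB : ∀ i j → i < p → j < p → b i (p N.+ j) ≈ β * fund R m i j)
        (hG : ∀ i j → i < p → j < p → b (p N.+ i) j ≈ γ * fund R m i j)
        (hR : ∀ i j → p ≤ i → p ≤ j → i < p N.+ p → j < p N.+ p →
          b i j ≈ b (i N.∸ 1) j + m * b (i N.∸ 1) (j N.∸ 1) + b i (j N.∸ 1))
        where

        private
          δ : Carrier
          δ = pow R m p * α + β + γ

          -- Indexing by i + p rather than p + i makes i + p ∸ 1 reduce to the predecessor index.
          h : ℕ → ℕ → Carrier
          h i j = b (i N.+ p) (j N.+ p)

          0<p : 0 < p
          0<p = s≤s z≤n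

          p-1<p : p-1 < p
          p-1<p = NP.n<1+n p-1

          recurrence : ∀ i j → i < p → j < p →
            h i j ≈ b (i N.+ p N.∸ 1) (j N.+ p) + m * b (i N.+ p N.∸ 1) (j N.+ p N.∸ 1) + b (i N.+ p) (j N.+ p N.∸ 1)
          recurrence i j i<p j<p =
            hR (i N.+ p) (j N.+ p) (NP.m≤n+m p i) (NP.m≤n+m p j) (NP.+-monoˡ-< p i<p) (NP.+-monoˡ-< p j<p)

          hB′ : ∀ j → j < p → b p-1 (j N.+ p) ≈ β * fund R m p-1 j
          hB′ j j<p = trans (reflexive (≡.cong (b p-1) (NP.+-comm j p))) (hB p-1 j p-1<p j<p)

          hG′ : ∀ i → i < p → b (i N.+ p) p-1 ≈ γ * fund R m i p-1
          hG′ i i<p = trans (reflexive (≡.cong (λ k → b k p-1) (NP.+-comm i p))) (hG i p-1 i<p p-1<p)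

          corner : h 0 0 ≈ δ
          corner = begin
            h 0 0                                                                      ≈⟨ recurrence 0 0 0<p 0<p ⟩
            b p-1 p + m * b p-1 p-1 + b p p-1                                          ≈⟨ +-cong (+-cong (hB′ 0 0<p)
                                                                                            (*-congˡ (hA p-1 p-1 p-1<p p-1<p))) (hG′ 0 0<p) ⟩
            β * fund R m p-1 0 + m * (α * fund R m p-1 p-1) + γ * fund R m 0 p-1       ≈⟨ +-cong (+-cong (*-congˡ (fund-zeroʳ m p-1))
                                                                                            (x∙yz≈y∙xz m α _)) refl ⟩
            β * 1# + α * (m * fund R m p-1 p-1) + γ * 1#                               ≈⟨ +-cong (+-cong (*-identityʳ β)
                                                                                            (*-congˡ m*fund[p-1,p-1]≈mᵖ)) (*-identityʳ γ) ⟩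
            β + α * pow R m p + γ                                                      ≈⟨ +-congʳ (trans (+-comm β _) (+-congʳ (*-comm α _))) ⟩
            δ                                                                          ∎

          top : ∀ j → j < p → h 0 j ≈ δ
          top zero    _     = corner
          top (suc j) 1+j<p = begin
            h 0 (suc j)                                                    ≈⟨ recurrence 0 (suc j) 0<p 1+j<p ⟩
            b p-1 (suc j N.+ p) + m * b p-1 (j N.+ p) + h 0 j              ≈⟨ +-cong (+-cong (hB′ (suc j) 1+j<p)
                                                                                (*-congˡ (hB′ j (NP.<⇒≤ 1+j<p)))) (top j (NP.<⇒≤ 1+j<p)) ⟩
            β * fund R m p-1 (suc j) + m * (β * fund R m p-1 j) + δ        ≈⟨ +-congʳ (*-distrib-+m* m β _ _) ⟩
            β * (fund R m p-1 (suc j) + m * fund R m p-1 j) + δ            ≈⟨ +-congʳ (*-congˡ (fund-row-[p-1]-step j 1+j<p)) ⟩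
            β * 0# + δ                                                     ≈⟨ +-congʳ (zeroʳ β) ⟩
            0# + δ                                                         ≈⟨ +-identityˡ δ ⟩
            δ                                                              ∎

          left : ∀ i → i < p → h i 0 ≈ δ
          left zero    _     = corner
          left (suc i) 1+i<p = begin
            h (suc i) 0                                                    ≈⟨ recurrence (suc i) 0 1+i<p 0<p ⟩
            h i 0 + m * b (i N.+ p) p-1 + b (suc i N.+ p) p-1              ≈⟨ +-cong (+-cong (left i (NP.<⇒≤ 1+i<p))
                                                                                (*-congˡ (hG′ i (NP.<⇒≤ 1+i<p)))) (hG′ (suc i) 1+i<p) ⟩
            δ + m * (γ * fund R m i p-1) + γ * fund R m (suc i) p-1        ≈⟨ trans (+-assoc δ _ _) (+-congˡ (+-comm _ _)) ⟩
            δ + (γ * fund R m (suc i) p-1 + m * (γ * fund R m i p-1))      ≈⟨ +-congˡ (*-distrib-+m* m γ _ _) ⟩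
            δ + γ * (fund R m (suc i) p-1 + m * fund R m i p-1)            ≈⟨ +-congˡ (*-congˡ (fund-column-[p-1]-step i 1+i<p)) ⟩
            δ + γ * 0#                                                     ≈⟨ +-congˡ (zeroʳ γ) ⟩
            δ + 0#                                                         ≈⟨ +-identityʳ δ ⟩
            δ                                                              ∎

        fund-lowerRightBlock : ∀ i j → i < p → j < p → b (p N.+ i) (p N.+ j) ≈ δ * fund R m i j
        fund-lowerRightBlock i j i<p j<p = begin
          b (p N.+ i) (p N.+ j) ≡⟨ ≡.cong₂ b (NP.+-comm p i) (NP.+-comm p j) ⟩
          h i j                 ≈⟨ fund-unique m p δ h top left (λ i j → recurrence (suc i) (suc j)) i j i<p j<p ⟩
          δ * fund R m i j      ∎

lemma3p5 : {c ℓ : Level} (p k : ℕ) → Prime p → 1 ≤ k →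
    (K : FiniteField (p N.^ k) c ℓ) →
    let open FiniteField K in
    (m α β γ : Carrier) (b : ℕ → ℕ → Carrier) →
    (∀ i j → i < p → j < p → b i j ≈ α * fund commRing m i j) →
    (∀ i j → i < p → j < p → b i (p N.+ j) ≈ β * fund commRing m i j) →
    (∀ i j → i < p → j < p → b (p N.+ i) j ≈ γ * fund commRing m i j) →
    (∀ i j → p ≤ i → p ≤ j → i < p N.+ p → j < p N.+ p →
      b i j ≈ b (i N.∸ 1) j + m * b (i N.∸ 1) (j N.∸ 1) + b i (j N.∸ 1)) →
    ∀ i j → i < p → j < p →
      b (p N.+ i) (p N.+ j) ≈ (pow commRing m p * α + β + γ) * fund commRing m i j
lemma3p5 zero      k () _
lemma3p5 (suc p-1) k pp _ K =
  fund-lowerRightBlock (FiniteField.commRing K) p-1 pp (characteristic K (suc p-1) k ≡.refl)
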